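{- Let $\vec p$ be an abstract multi-polynomial in $x_1,\dots,x_n$. Then $\vec p$ has a unique maximal iterative fragment (with respect to the fragment order $\sqsubseteq$).
   Context: An abstract polynomial over $x_1,\dots,x_n$ is a finite set of monomials (equivalently, a polynomial with coefficients in the Boolean semiring $\{0,1\}$, $1+1=1$); an abstract multi-polynomial (AMP) is an $n$-tuple $\vec p=\langle\vec p[1],\dots,\vec p[n]\rangle$ of abstract polynomials. $\vec p\sqsubseteq\vec q$ ($\vec p$ is a fragment of $\vec q$) if every monomial of $\vec p[i]$ appears in $\vec q[i]$ for all $i$. The set of self-dependent indices is $\mathrm{sd}(\vec p)=\{i: x_i \text{ occurs in } \vec p[i]\}$. A monomial is iterative with respect to $\vec p$ if all variables occurring in it have indices in $\mathrm{sd}(\vec p)$; $\vec p$ is iterative if every monomial of every component of $\vec p$ is iterative with respect to $\vec p$. -}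

module Defs where

open import Data.Nat using (ℕ)
open import Data.Nat.Base using (NonZero)
open import Data.Fin using (Fin)
open import Data.Vec using (Vec; lookup)
open import Data.List using (List)
open import Data.List.Membership.Propositional using (_∈_)
open import Data.Product using (Σ; _×_)

Monomial : ℕ → Set
Monomial n = Vec ℕ n

Occurs : {n : ℕ} → Fin n → Monomial n → Set
Occurs i m = NonZero (lookup m i)

-- An abstract polynomial: a finite set of monomials, represented as a list;
-- only membership matters (set semantics; duplicates/order irrelevant).
AbsPoly : ℕ → Set
AbsPoly n = List (Monomial n)

AMP : ℕ → Set
AMP n = Fin n → AbsPoly n

_⊑_ : {n : ℕ} → AMP n → AMP n → Set
p ⊑ q = ∀ i m → m ∈ p i → m ∈ q i

_≈_ : {n : ℕ} → AMP n → AMP n → Set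
p ≈ q = (p ⊑ q) × (q ⊑ p)

SelfDep : {n : ℕ} → AMP n → Fin n → Set
SelfDep p i = Σ (Monomial _) λ m → (m ∈ p i) × Occurs i m

IterativeMono : {n : ℕ} → AMP n → Monomial n → Set
IterativeMono p m = ∀ j → Occurs j m → SelfDep p j

Iterative : {n : ℕ} → AMP n → Set
Iterative p = ∀ i m → m ∈ p i → IterativeMono p m

IterativeFragment : {n : ℕ} → AMP n → AMP n → Set
IterativeFragment p f = Iterative f × (f ⊑ p)

MaximalIterativeFragment : {n : ℕ} → AMP n → AMP n → Set
MaximalIterativeFragment p f =
  IterativeFragment p f × (∀ g → IterativeFragment p g → f ⊑ g → g ≈ f)

-- Iterate the deflationary map S ↦ sd(p restricted to monomials over S),
-- starting from the full index set, until S ⊆ sdStep S; then the restriction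
-- of p to S is iterative. Every iterative fragment of p keeps its
-- self-dependent indices inside each iterate, so it lies below that
-- restriction. Hence p has a greatest iterative fragment, which is
-- necessarily its unique maximal one.
module Submission where

open import Defs
open import Data.Nat using (ℕ)
open import Data.Nat.Properties using (nonZero?)
open import Data.Fin using (Fin)
open import Data.Fin.Properties using (¬∀⟶∃¬; all?)
open import Data.Fin.Subset using (Subset; ⊤; _⊆_; _⊂_) renaming (_∈_ to _∈ₛ_)
open import Data.Fin.Subset.Properties using (_∈?_; ∈⊤)
open import Data.Fin.Subset.Induction using (⊂-wellFounded; Acc; acc)
open import Data.Vec using (lookup; tabulate)
open import Data.Vec.Properties using (lookup∘tabulate; []=⇒lookup; lookup⇒[]=)
open import Data.List using (filter)
open import Data.List.Relation.Unary.Any using (any?)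
open import Data.List.Membership.Propositional using (_∈_; find; lose)
open import Data.List.Membership.Propositional.Properties using (∈-filter⁺; ∈-filter⁻)
open import Data.Product using (Σ; Σ-syntax; _×_; _,_; proj₁; proj₂)
open import Data.Sum using (_⊎_; inj₁; inj₂)
open import Function using (_∘_)
open import Level using (Level)
open import Relation.Nullary using (Dec; yes; no; ¬_; does; contradiction)
open import Relation.Nullary.Decidable using (map′; dec-true; decidable-stable; _→-dec_)
open import Relation.Unary using (Pred; Decidable)
open import Relation.Binary.PropositionalEquality using (sym; trans)

private
  variable
    n : ℕ

tabulate-does⁺ : {ℓ : Level} {P : Pred (Fin n) ℓ} (P? : Decidable P) {i : Fin n} →
                 P i → i ∈ₛ tabulate (does ∘ P?)
tabulate-does⁺ P? {i} Pi =
  lookup⇒[]= i _ (trans (lookup∘tabulate (does ∘ P?) i) (dec-true (P? i) Pi))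

tabulate-does⁻ : {ℓ : Level} {P : Pred (Fin n) ℓ} (P? : Decidable P) {i : Fin n} →
                 i ∈ₛ tabulate (does ∘ P?) → P i
tabulate-does⁻ P? {i} i∈ with P? i | lookup∘tabulate (does ∘ P?) i
... | yes Pi | _ = Pi
... | no _ | lookup≡false with () ← trans (sym lookup≡false) ([]=⇒lookup i∈)

⊆⇒⊇⊎⊂ : {S U : Subset n} → U ⊆ S → S ⊆ U ⊎ U ⊂ S
⊆⇒⊇⊎⊂ {n} {S} {U} U⊆S with all? (λ x → x ∈? S →-dec x ∈? U)
... | yes S⊆U = inj₁ (S⊆U _)
... | no S⊈U with x , x∈S⇏x∈U ← ¬∀⟶∃¬ n _ (λ x → x ∈? S →-dec x ∈? U) S⊈U =
  inj₂ (U⊆S , x , x∈S , x∉U)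
  where
  x∈S : x ∈ₛ S
  x∈S = decidable-stable (x ∈? S) (λ x∉S → x∈S⇏x∈U (λ x∈S → contradiction x∈S x∉S))
  x∉U : ¬ x ∈ₛ U
  x∉U x∈U = x∈S⇏x∈U (λ _ → x∈U)

module _ (f : Subset n → Subset n) (f-⊆ : ∀ S → f S ⊆ S) where

  postfixedPoint : {ℓ : Level} (P : Pred (Subset n) ℓ) → (∀ {S} → P S → P (f S)) →
                   ∀ {S} → P S → Σ[ T ∈ Subset n ] T ⊆ f T × P T
  postfixedPoint P f-preserves-P {S} = descend S (⊂-wellFounded S)
    where
    descend : ∀ S → Acc _⊂_ S → P S → Σ[ T ∈ Subset n ] T ⊆ f T × P T
    descend S (acc smaller) PS with ⊆⇒⊇⊎⊂ (f-⊆ S)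
    ... | inj₁ S⊆fS = S , S⊆fS , PS
    ... | inj₂ fS⊂S = descend (f S) (smaller fS⊂S) (f-preserves-P PS)

occurs? : (i : Fin n) (m : Monomial n) → Dec (Occurs i m)
occurs? i m = nonZero? (lookup m i)

selfDep? : (f : AMP n) (i : Fin n) → Dec (SelfDep f i)
selfDep? f i = map′ find (λ (_ , m∈ , occ) → lose m∈ occ) (any? (occurs? i) (f i))

SelfDep-mono : {f g : AMP n} → f ⊑ g → ∀ {i} → SelfDep f i → SelfDep g i
SelfDep-mono f⊑g {i} (m , m∈f , occ) = m , f⊑g i m m∈f , occ

sd : AMP n → Subset n
sd f = tabulate (does ∘ selfDep? f)

SupportedIn : Subset n → Monomial n → Set
SupportedIn S m = ∀ j → Occurs j m → j ∈ₛ S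

supportedIn? : (S : Subset n) (m : Monomial n) → Dec (SupportedIn S m)
supportedIn? S m = all? (λ j → occurs? j m →-dec j ∈? S)

restrict : AMP n → Subset n → AMP n
restrict p S i = filter (supportedIn? S) (p i)

module _ (p : AMP n) where

  restrict-⊑ : ∀ S → restrict p S ⊑ p
  restrict-⊑ S i m m∈ = proj₁ (∈-filter⁻ (supportedIn? S) {xs = p i} m∈)

  supportedIn-restrict : ∀ S i m → m ∈ restrict p S i → SupportedIn S m
  supportedIn-restrict S i m m∈ = proj₂ (∈-filter⁻ (supportedIn? S) {xs = p i} m∈)

  sdStep : Subset n → Subset n
  sdStep S = sd (restrict p S)

  sdStep-⊆ : ∀ S → sdStep S ⊆ S
  sdStep-⊆ S j∈ with m , m∈ , occ ← tabulate-does⁻ (selfDep? (restrict p S)) j∈ =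
    supportedIn-restrict S _ m m∈ _ occ

  restrict-iterative : ∀ {S} → S ⊆ sdStep S → Iterative (restrict p S)
  restrict-iterative {S} S⊆sdStep i m m∈ j occ =
    tabulate-does⁻ (selfDep? (restrict p S)) (S⊆sdStep (supportedIn-restrict S i m m∈ j occ))

  SdBound : Subset n → Set
  SdBound S = ∀ g → IterativeFragment p g → ∀ j → SelfDep g j → j ∈ₛ S

  iterativeFragment-⊑-restrict : ∀ {S} → SdBound S →
                                 ∀ g → IterativeFragment p g → g ⊑ restrict p S
  iterativeFragment-⊑-restrict bound g g-frag@(g-iter , g⊑p) i m m∈g =
    ∈-filter⁺ (supportedIn? _) (g⊑p i m m∈g) (λ j occ → bound g g-frag j (g-iter i m m∈g j occ))

  sdStep-preserves-SdBound : ∀ {S} → SdBound S → SdBound (sdStep S)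
  sdStep-preserves-SdBound {S} bound g g-frag j sd-j =
    tabulate-does⁺ (selfDep? (restrict p S))
      (SelfDep-mono (iterativeFragment-⊑-restrict bound g g-frag) sd-j)

  greatestIterativeFragment :
    Σ[ F ∈ AMP n ] IterativeFragment p F × (∀ g → IterativeFragment p g → g ⊑ F)
  greatestIterativeFragment
    with S , S⊆sdStep , bound ← postfixedPoint sdStep sdStep-⊆ SdBound
                                  sdStep-preserves-SdBound {⊤} (λ _ _ _ _ → ∈⊤) =
    restrict p S , (restrict-iterative S⊆sdStep , restrict-⊑ S) ,
    iterativeFragment-⊑-restrict bound

greatest⇒uniqueMaximal : {p F : AMP n} → IterativeFragment p F →
                         (∀ g → IterativeFragment p g → g ⊑ F) →
                         MaximalIterativeFragment p F × (∀ g → MaximalIterativeFragment p g → g ≈ F)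
greatest⇒uniqueMaximal {F = F} F-frag greatest =
  (F-frag , λ g g-frag F⊑g → greatest g g-frag , F⊑g) ,
  λ g (g-frag , g-max) → greatest g g-frag , proj₁ (g-max F F-frag (greatest g g-frag))

mainTheorem4 : (n : ℕ) (p : AMP n) →
    Σ (AMP n) λ f → MaximalIterativeFragment p f
      × (∀ g → MaximalIterativeFragment p g → g ≈ f)
mainTheorem4 n p with F , F-frag , greatest ← greatestIterativeFragment p =
  F , greatest⇒uniqueMaximal F-frag greatest
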